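{- Let $p$ be a prime, $q=p^m$, let $\alpha\in\mathbb{F}_{q^3}$ generate a normal basis $\{\alpha,\alpha^q,\alpha^{q^2}\}$ of $\mathbb{F}_{q^3}$ over $\mathbb{F}_q$, and let $A,B,C\in\mathbb{F}_{q^3}$ with $A\neq0$ and $B\neq0$. Then it cannot happen that the surface $\mathcal{S}_1$ defined below has exactly four singular points which are $\mathbb{F}_{q^4}$-rational and all conjugate to each other, i.e. form a single orbit of length $4$ under the Frobenius map $(a_0,a_1,a_2)\mapsto(a_0^q,a_1^q,a_2^q)$.
   Context: Put $D=C+C^q+C^{q^2}\in\mathbb{F}_q$. For $j=0,1,2$ let $\xi_j=x_0\alpha^{q^j}+x_1\alpha^{q^{j+1}}+x_2\alpha^{q^{j+2}}$ (with $\alpha^{q^3}=\alpha$) and $F=-\xi_0\xi_1\xi_2+\sum_{j=0}^{2}(A^{q^j}\xi_j^2+B^{q^j}\xi_j)+D\in\mathbb{F}_q[x_0,x_1,x_2]$. $\mathcal{S}_1$ is the affine surface $F=0$ in $\mathbb{A}^3(\overline{\mathbb{F}}_q)$; a singular point is a point where $F$ and its three partial derivatives vanish. -}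

module Defs where

open import Level using (Level; _⊔_) renaming (suc to lsuc)
open import Data.Nat using (ℕ; zero; suc) renaming (_^_ to _^ℕ_)
open import Data.Fin using (Fin; zero; suc)
open import Data.List using (List; []; _∷_)
open import Data.Product using (_×_; _,_; ∃-syntax)
open import Data.Sum using (_⊎_)
open import Relation.Nullary using (¬_)
open import Relation.Binary.PropositionalEquality using (_≢_)
open import Algebra.Bundles using (CommutativeRing)

record Field (c ℓ : Level) : Set (lsuc (c ⊔ ℓ)) where
  field
    commRing : CommutativeRing c ℓ
  open CommutativeRing commRing public using (Carrier; _≈_; _+_; _*_; -_; 0#; 1#)
  field
    1≉0 : ¬ (1# ≈ 0#)
    inverse : ∀ x → ¬ (x ≈ 0#) → ∃[ y ] (x * y ≈ 1#)

data Expr {c} (K : Set c) : Set c where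
  var : Fin 3 → Expr K
  con : K → Expr K
  _⊕_ : Expr K → Expr K → Expr K
  _⊗_ : Expr K → Expr K → Expr K
  ⊖_  : Expr K → Expr K

module FieldDefs {c ℓ : Level} (K : Field c ℓ) where
  open Field K public

  pw : Carrier → ℕ → Carrier
  pw x zero = 1#
  pw x (suc n) = x * pw x n

  _×1 : ℕ → Carrier
  zero ×1 = 0#
  suc n ×1 = 1# + n ×1

  HasChar : ℕ → Set ℓ
  HasChar p = p ×1 ≈ 0#

  -- monic polynomial with coefficient list [c₀,…,c_{n-1}] evaluated at x:
  -- c₀ + c₁ x + … + c_{n-1} x^{n-1} + x^n   (Horner form)
  monic : List Carrier → Carrier → Carrier
  monic [] x = 1#
  monic (a ∷ as) x = a + x * monic as x

  IsAlgClosed : Set (c ⊔ ℓ)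
  IsAlgClosed = ∀ a as → ∃[ x ] (monic (a ∷ as) x ≈ 0#)

  In𝔽 : ℕ → ℕ → Carrier → Set ℓ
  In𝔽 q n x = pw x (q ^ℕ n) ≈ x

  NormalBasisGen : ℕ → Carrier → Set (c ⊔ ℓ)
  NormalBasisGen q α =
    In𝔽 q 3 α ×
    (∀ a₀ a₁ a₂ → In𝔽 q 1 a₀ → In𝔽 q 1 a₁ → In𝔽 q 1 a₂ →
      (a₀ * α) + ((a₁ * pw α q) + (a₂ * pw α (q ^ℕ 2))) ≈ 0# →
      (a₀ ≈ 0#) × (a₁ ≈ 0#) × (a₂ ≈ 0#))

  Point : Set c
  Point = Carrier × Carrier × Carrier

  coord : Point → Fin 3 → Carrier
  coord (a , b , d) zero = a
  coord (a , b , d) (suc zero) = b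
  coord (a , b , d) (suc (suc zero)) = d

  eval : Expr Carrier → Point → Carrier
  eval (var i) P = coord P i
  eval (con k) P = k
  eval (e ⊕ f) P = eval e P + eval f P
  eval (e ⊗ f) P = eval e P * eval f P
  eval (⊖ e) P = - eval e P

  deriv : Fin 3 → Expr Carrier → Expr Carrier
  deriv i (var j) with i Data.Fin.≟ j
  ... | Relation.Nullary.yes _ = con 1#
  ... | Relation.Nullary.no _ = con 0#
  deriv i (con k) = con 0#
  deriv i (e ⊕ f) = deriv i e ⊕ deriv i f
  deriv i (e ⊗ f) = (deriv i e ⊗ f) ⊕ (e ⊗ deriv i f)
  deriv i (⊖ e) = ⊖ deriv i e

  -- the surface 𝒮₁ :  F = -ξ₀ξ₁ξ₂ + Σ_j (A^{q^j} ξ_j² + B^{q^j} ξ_j) + D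
  module Surface (q : ℕ) (α A B C : Carrier) where
    fr : ℕ → Carrier → Carrier
    fr j x = pw x (q ^ℕ j)

    ξ : ℕ → Expr Carrier
    ξ j = ((var zero ⊗ con (fr j α)) ⊕ (var (suc zero) ⊗ con (fr (suc j) α)))
            ⊕ (var (suc (suc zero)) ⊗ con (fr (suc (suc j)) α))

    D : Carrier
    D = C + (fr 1 C + fr 2 C)

    term : ℕ → Expr Carrier
    term j = (con (fr j A) ⊗ (ξ j ⊗ ξ j)) ⊕ (con (fr j B) ⊗ ξ j)

    F : Expr Carrier
    F = ((⊖ ((ξ 0 ⊗ ξ 1) ⊗ ξ 2)) ⊕ ((term 0 ⊕ term 1) ⊕ term 2)) ⊕ con D

    Singular : Point → Set ℓ
    Singular P = (eval F P ≈ 0#) × (∀ i → eval (deriv i F) P ≈ 0#)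

  _≈P_ : Point → Point → Set ℓ
  (a , b , d) ≈P (a' , b' , d') = (a ≈ a') × (b ≈ b') × (d ≈ d')

  frobP : ℕ → ℕ → Point → Point
  frobP q k (a , b , d) = pw a (q ^ℕ k) , pw b (q ^ℕ k) , pw d (q ^ℕ k)

  orbit4 : ℕ → Point → Fin 4 → Point
  orbit4 q P zero = P
  orbit4 q P (suc zero) = frobP q 1 P
  orbit4 q P (suc (suc zero)) = frobP q 2 P
  orbit4 q P (suc (suc (suc zero))) = frobP q 3 P

  FourConjugateSingular : ℕ → Carrier → Carrier → Carrier → Carrier → Set (c ⊔ ℓ)
  FourConjugateSingular q α A B C =
    ∃[ P ] ( (frobP q 4 P ≈P P)
           × (∀ i j → i ≢ j → ¬ (orbit4 q P i ≈P orbit4 q P j))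
           × (∀ Q → Singular Q → ∃[ i ] (Q ≈P orbit4 q P i))
           × (∀ i → Singular (orbit4 q P i)) )
    where open Surface q α A B C

{-# OPTIONS --safe #-}
-- In the coordinates ξ = (ξ₀, ξ₁, ξ₂) the polynomial F is the cubic
-- f(u) = −u₀u₁u₂ + Σⱼ (aⱼuⱼ² + bⱼuⱼ) + D, and since the Jacobian of ξ is the
-- (symmetric, nonsingular) Moore matrix of the normal basis, singular points of
-- 𝒮₁ are exactly the critical zeros of f. For two critical zeros u, v of f the
-- trapezoid rule, exact up to the cubic term, forces (v₀−u₀)(v₁−u₁)(v₂−u₂) = 0.
-- The Frobenius acts on ξ-coordinates by x ↦ x^q followed by a cyclic shift, so
-- for a singular P with φ⁴P = P each ξ-coordinate of P is φ⁴ of the previous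
-- one. Applying the above to P and φP, one coordinate of ξ(φP) and ξ(P) agrees,
-- the agreement propagates around the cycle, so ξ(φP) = ξ(P) and φP = P: the
-- orbit cannot have length 4. Only P, φP and φ⁴P = P enter. Equality in K is not decidable, so the argument runs
-- under double negation.
module Submission where

open import Defs
open import Data.Nat using (ℕ; zero; suc; _<_; _≤_; _∸_; _!; s≤s; z≤n; NonZero)
import Data.Nat as ℕ
import Data.Nat.Properties as ℕ
open import Data.Nat.Divisibility using (_∣_; _∤_; >⇒∤; m∣m*n; divides-refl)
open import Data.Nat.Primality using (Prime; euclidsLemma; prime⇒nonTrivial; prime⇒nonZero)
open import Data.Nat.Combinatorics using (_C_; nCn≡1; k![n∸k]!∣n!)
open import Data.Nat.Combinatorics.Specification using (nCk≡n!/k![n-k]!)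
open import Data.Nat.DivMod using (m*[n/m]≡n)
open import Data.Integer as ℤ using (ℤ; +_; -[1+_]; sign; ∣_∣)
import Data.Integer.Properties as ℤ
open import Data.Sign as Sign using (Sign)
import Data.Fin as Fin
open import Data.Fin using (Fin; zero; suc; toℕ; fromℕ)
import Data.Fin.Properties as Fin
open import Data.Maybe using (Maybe; just; nothing)
open import Data.Product using (_,_; proj₁; proj₂)
open import Data.Sum using (_⊎_; inj₁; inj₂; [_,_]′)
open import Data.Empty using (⊥-elim)
open import Function using (_∘_)
open import Relation.Nullary using (¬_; yes; no)
open import Relation.Binary.PropositionalEquality as ≡ using (_≡_)
open import Algebra.Bundles using (CommutativeRing; CommutativeSemiring)
open import Relation.Binary.Bundles using (Setoid)
open import Data.Product.Relation.Binary.Pointwise.NonDependent using (×-setoid)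
import Algebra.Solver.Ring
import Algebra.Solver.Ring.AlmostCommutativeRing as ACR

module IntegerCoefficients {c ℓ} (R : CommutativeRing c ℓ) where
  open CommutativeRing R
  open import Algebra.Properties.Semiring.Mult semiring using (_×_; ×-homo-+; ×1-homo-*)
  open import Algebra.Properties.Ring ring using (-‿involutive; -0#≈0#; -‿distribˡ-*; -‿distribʳ-*)
  open import Algebra.Properties.AbelianGroup +-abelianGroup using (⁻¹-∙-comm; xyx⁻¹≈y)
  open import Relation.Binary.Reasoning.Setoid setoid

  signed : Sign → Carrier → Carrier
  signed Sign.+ x = x
  signed Sign.- x = - x

  fromℤ : ℤ → Carrier
  fromℤ i = signed (sign i) (∣ i ∣ × 1#)

  signed-0 : ∀ s → signed s 0# ≈ 0#
  signed-0 Sign.+ = refl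
  signed-0 Sign.- = -0#≈0#

  signed-cong : ∀ s {x y} → x ≈ y → signed s x ≈ signed s y
  signed-cong Sign.+ x≈y = x≈y
  signed-cong Sign.- x≈y = -‿cong x≈y

  signed-* : ∀ s t x y → signed (s Sign.* t) (x * y) ≈ signed s x * signed t y
  signed-* Sign.+ Sign.+ x y = refl
  signed-* Sign.+ Sign.- x y = -‿distribʳ-* x y
  signed-* Sign.- Sign.+ x y = -‿distribˡ-* x y
  signed-* Sign.- Sign.- x y = begin
    x * y         ≈⟨ -‿involutive (x * y) ⟨
    - - (x * y)   ≈⟨ -‿cong (-‿distribʳ-* x y) ⟩
    - (x * - y)   ≈⟨ -‿distribˡ-* x (- y) ⟩
    - x * - y     ∎

  fromℤ-◃ : ∀ s n → fromℤ (s ℤ.◃ n) ≈ signed s (n × 1#)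
  fromℤ-◃ s       zero    = sym (signed-0 s)
  fromℤ-◃ Sign.+ (suc n) = refl
  fromℤ-◃ Sign.- (suc n) = refl

  1+x-[1+y]≈x-y : ∀ x y → (1# + x) - (1# + y) ≈ x - y
  1+x-[1+y]≈x-y x y = begin
    (1# + x) - (1# + y)       ≈⟨ +-congˡ (-‿cong (+-comm 1# y)) ⟩
    (1# + x) + - (y + 1#)     ≈⟨ +-congˡ (⁻¹-∙-comm y 1#) ⟨
    (1# + x) + (- y + - 1#)   ≈⟨ +-assoc (1# + x) (- y) (- 1#) ⟨
    ((1# + x) - y) - 1#       ≈⟨ +-congʳ (+-assoc 1# x (- y)) ⟩
    (1# + (x - y)) - 1#       ≈⟨ xyx⁻¹≈y 1# (x - y) ⟩
    x - y                     ∎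

  fromℤ-⊖ : ∀ m n → fromℤ (m ℤ.⊖ n) ≈ m × 1# - n × 1#
  fromℤ-⊖ zero    zero    = sym (-‿inverseʳ 0#)
  fromℤ-⊖ zero    (suc n) = sym (+-identityˡ _)
  fromℤ-⊖ (suc m) zero    = sym (trans (+-congˡ -0#≈0#) (+-identityʳ _))
  fromℤ-⊖ (suc m) (suc n) = begin
    fromℤ (suc m ℤ.⊖ suc n)          ≡⟨ ≡.cong fromℤ (ℤ.[1+m]⊖[1+n]≡m⊖n m n) ⟩
    fromℤ (m ℤ.⊖ n)                  ≈⟨ fromℤ-⊖ m n ⟩
    m × 1# - n × 1#                  ≈⟨ 1+x-[1+y]≈x-y (m × 1#) (n × 1#) ⟨
    suc m × 1# - suc n × 1#          ∎

  fromℤ-+ : ∀ i j → fromℤ (i ℤ.+ j) ≈ fromℤ i + fromℤ j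
  fromℤ-+ -[1+ m ] -[1+ n ] = begin
    - (suc (suc (m ℕ.+ n)) × 1#)        ≡⟨ ≡.cong (λ k → - (suc k × 1#)) (ℕ.+-suc m n) ⟨
    - ((suc m ℕ.+ suc n) × 1#)          ≈⟨ -‿cong (×-homo-+ 1# (suc m) (suc n)) ⟩
    - (suc m × 1# + suc n × 1#)         ≈⟨ ⁻¹-∙-comm (suc m × 1#) (suc n × 1#) ⟨
    - (suc m × 1#) + - (suc n × 1#)     ∎
  fromℤ-+ -[1+ m ] (+ n)    = trans (fromℤ-⊖ n (suc m)) (+-comm _ _)
  fromℤ-+ (+ m)    -[1+ n ] = fromℤ-⊖ m (suc n)
  fromℤ-+ (+ m)    (+ n)    = ×-homo-+ 1# m n

  fromℤ-* : ∀ i j → fromℤ (i ℤ.* j) ≈ fromℤ i * fromℤ j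
  fromℤ-* i j = begin
    fromℤ (i ℤ.* j)                                                ≈⟨ fromℤ-◃ (sign i Sign.* sign j) (∣ i ∣ ℕ.* ∣ j ∣) ⟩
    signed (sign i Sign.* sign j) ((∣ i ∣ ℕ.* ∣ j ∣) × 1#)         ≈⟨ signed-cong (sign i Sign.* sign j) (×1-homo-* ∣ i ∣ ∣ j ∣) ⟩
    signed (sign i Sign.* sign j) (∣ i ∣ × 1# * ∣ j ∣ × 1#)        ≈⟨ signed-* (sign i) (sign j) _ _ ⟩
    fromℤ i * fromℤ j                                              ∎

  fromℤ-‿ : ∀ i → fromℤ (ℤ.- i) ≈ - fromℤ i
  fromℤ-‿ -[1+ n ]  = sym (-‿involutive _)
  fromℤ-‿ (+ zero)  = sym -0#≈0#
  fromℤ-‿ (+ suc n) = refl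

  ℤ⟶R : ℤ.+-*-rawRing ACR.-Raw-AlmostCommutative⟶ ACR.fromCommutativeRing R
  ℤ⟶R = record
    { ⟦_⟧ = fromℤ ; +-homo = fromℤ-+ ; *-homo = fromℤ-* ; -‿homo = fromℤ-‿
    ; 0-homo = refl ; 1-homo = +-identityʳ 1# }

  fromℤ-≟ : ∀ i j → Maybe (fromℤ i ≈ fromℤ j)
  fromℤ-≟ i j with i ℤ.≟ j
  ... | yes ≡.refl = just refl
  ... | no _       = nothing

  open Algebra.Solver.Ring ℤ.+-*-rawRing (ACR.fromCommutativeRing R) ℤ⟶R fromℤ-≟ public
    using (solve; _:=_; _:+_; _:-_; _:*_; :-_; con)

-- Binomial coefficients and the freshman's dream

n∣n! : ∀ n → .{{NonZero n}} → n ∣ n !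
n∣n! (suc n) = m∣m*n (n !)

k![n∸k]!*nCk≡n! : ∀ {n k} → k ≤ n → k ! ℕ.* (n ∸ k) ! ℕ.* (n C k) ≡ n !
k![n∸k]!*nCk≡n! {n} {k} k≤n =
  ≡.trans (≡.cong (k ! ℕ.* (n ∸ k) ! ℕ.*_) (nCk≡n!/k![n-k]! k≤n)) (m*[n/m]≡n (k![n∸k]!∣n! k≤n))
  where instance _ = ℕ._!*_!≢0 k (n ∸ k)

module _ {p} (p-prime : Prime p) where

  private
    1<p : 1 < p
    1<p = ℕ.nonTrivial⇒n>1 p {{prime⇒nonTrivial p-prime}}

  prime∤! : ∀ {j} → j < p → p ∤ j !
  prime∤! {zero}  _   = >⇒∤ 1<p
  prime∤! {suc j} j<p p∣j! =
    [ >⇒∤ j<p , prime∤! (ℕ.<-trans (ℕ.n<1+n j) j<p) ]′ (euclidsLemma (suc j) (j !) p-prime p∣j!)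

  prime∣C : ∀ {k} → 0 < k → k < p → p ∣ p C k
  prime∣C {k} 0<k k<p
    with euclidsLemma (k ! ℕ.* (p ∸ k) !) (p C k) p-prime
           (≡.subst (p ∣_) (≡.sym (k![n∸k]!*nCk≡n! (ℕ.<⇒≤ k<p))) (n∣n! p {{prime⇒nonZero p-prime}}))
  ... | inj₂ p∣pCk       = p∣pCk
  ... | inj₁ p∣k![p∸k]! with euclidsLemma (k !) ((p ∸ k) !) p-prime p∣k![p∸k]!
  ...   | inj₁ p∣k!     = ⊥-elim (prime∤! k<p p∣k!)
  ...   | inj₂ p∣[p∸k]! = ⊥-elim (prime∤! (ℕ.∸-monoʳ-< 0<k (ℕ.<⇒≤ k<p)) p∣[p∸k]!)

module _ {a ℓ} (R : CommutativeSemiring a ℓ) where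
  open CommutativeSemiring R
  open import Algebra.Properties.Semiring.Mult semiring using (_×_; ×-assoc-*; ×-congʳ; ×1-homo-*)
  open import Algebra.Properties.Semiring.Exp semiring using (_^_; ^-congˡ; ^-assocʳ)
  open import Algebra.Properties.CommutativeSemiring.Binomial R using (theorem; binomialTerm)
  open import Algebra.Properties.Monoid.Sum +-monoid using (sum; sum-init-last; sum-cong-≋; sum-replicate-zero)
  open import Data.Vec.Functional using (init; last; replicate)
  open import Relation.Binary.Reasoning.Setoid setoid

  C×-vanish⇒^-distrib-+ : ∀ n → (∀ {k} → 0 < k → k < suc n → (suc n C k) × 1# ≈ 0#) →
                          ∀ x y → (x + y) ^ suc n ≈ x ^ suc n + y ^ suc n
  C×-vanish⇒^-distrib-+ n innerC≈0 x y = begin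
    (x + y) ^ suc n                                   ≈⟨ theorem (suc n) x y ⟩
    T Fin.zero + sum (T ∘ Fin.suc)                    ≈⟨ +-congˡ (sum-init-last (T ∘ Fin.suc)) ⟩
    T Fin.zero + (sum (init (T ∘ Fin.suc)) + last (T ∘ Fin.suc))
                                                      ≈⟨ +-cong first (+-cong inner final) ⟩
    y ^ suc n + (0# + x ^ suc n)                      ≈⟨ +-congˡ (+-identityˡ _) ⟩
    y ^ suc n + x ^ suc n                             ≈⟨ +-comm _ _ ⟩
    x ^ suc n + y ^ suc n                             ∎
    where
    T : Fin (suc (suc n)) → Carrier
    T = binomialTerm x y (suc n)
    k×z≈0 : ∀ {k} z → 0 < k → k < suc n → (suc n C k) × z ≈ 0#
    k×z≈0 {k} z 0<k k<n = begin
      (suc n C k) × z               ≈⟨ ×-congʳ (suc n C k) (*-identityˡ z) ⟨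
      (suc n C k) × (1# * z)        ≈⟨ ×-assoc-* (suc n C k) 1# z ⟨
      ((suc n C k) × 1#) * z        ≈⟨ *-congʳ (innerC≈0 0<k k<n) ⟩
      0# * z                        ≈⟨ zeroˡ z ⟩
      0#                            ∎
    first : T Fin.zero ≈ y ^ suc n
    first = trans (+-identityʳ _) (*-identityˡ _)
    inner : sum (init (T ∘ Fin.suc)) ≈ 0#
    inner = trans (sum-cong-≋ {n} {y = replicate n 0#} (λ i → k×z≈0 _ (s≤s z≤n) (s≤s (inject₁<n i))))
                  (sum-replicate-zero n)
      where
      inject₁<n : ∀ i → toℕ (Fin.inject₁ i) < n
      inject₁<n i = ≡.subst (_< n) (≡.sym (Fin.toℕ-inject₁ i)) (Fin.toℕ<n i)
    final : last (T ∘ Fin.suc) ≈ x ^ suc n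
    final = begin
      T (Fin.suc (fromℕ n))                            ≡⟨ ≡.cong (λ k → (suc n C suc k) × (x ^ suc k * y ^ (n ∸ k))) (Fin.toℕ-fromℕ n) ⟩
      (suc n C suc n) × (x ^ suc n * y ^ (n ∸ n))      ≡⟨ ≡.cong₂ (λ c e → c × (x ^ suc n * y ^ e)) (nCn≡1 (suc n)) (ℕ.n∸n≡0 n) ⟩
      (x ^ suc n * 1#) + 0#                             ≈⟨ trans (+-identityʳ _) (*-identityʳ _) ⟩
      x ^ suc n                                         ∎

  p∣k⇒k×1≈0 : ∀ {p k} → p × 1# ≈ 0# → p ∣ k → k × 1# ≈ 0#
  p∣k⇒k×1≈0 {p} char (divides-refl d) = trans (×1-homo-* d p) (trans (*-congˡ char) (zeroʳ _))

  freshmansDream : ∀ {p} → Prime p → p × 1# ≈ 0# → ∀ x y → (x + y) ^ p ≈ x ^ p + y ^ p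
  freshmansDream {suc n} p-prime char = C×-vanish⇒^-distrib-+ n (λ 0<k k<p → p∣k⇒k×1≈0 char (prime∣C p-prime 0<k k<p))

  freshmansDream-^ : ∀ {p} → Prime p → p × 1# ≈ 0# → ∀ m x y → (x + y) ^ (p ℕ.^ m) ≈ x ^ (p ℕ.^ m) + y ^ (p ℕ.^ m)
  freshmansDream-^ p-prime char zero    x y = trans (*-identityʳ _) (sym (+-cong (*-identityʳ x) (*-identityʳ y)))
  freshmansDream-^ {p} p-prime char (suc m) x y = begin
    (x + y) ^ (p ℕ.* p ℕ.^ m)                ≈⟨ ^-assocʳ (x + y) p (p ℕ.^ m) ⟨
    ((x + y) ^ p) ^ (p ℕ.^ m)                ≈⟨ ^-congˡ (p ℕ.^ m) (freshmansDream p-prime char x y) ⟩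
    (x ^ p + y ^ p) ^ (p ℕ.^ m)              ≈⟨ freshmansDream-^ p-prime char m (x ^ p) (y ^ p) ⟩
    (x ^ p) ^ (p ℕ.^ m) + (y ^ p) ^ (p ℕ.^ m) ≈⟨ +-cong (^-assocʳ x p (p ℕ.^ m)) (^-assocʳ y p (p ℕ.^ m)) ⟩
    x ^ (p ℕ.* p ℕ.^ m) + y ^ (p ℕ.* p ℕ.^ m) ∎

module _ {c ℓ} (K : Field c ℓ) where
  open FieldDefs K
  open CommutativeRing commRing
    using (refl; sym; trans; reflexive; setoid; semiring; commutativeSemiring; +-abelianGroup
          ; +-cong; +-congʳ; *-cong; *-congˡ; *-congʳ; -‿cong; _-_
          ; +-assoc; +-comm; +-identityˡ; +-identityʳ; *-assoc; *-comm; *-identityˡ; *-identityʳ; zeroˡ; zeroʳ)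
  open IntegerCoefficients commRing using (solve; _:=_; _:+_; _:-_; _:*_; :-_; con)
  open import Algebra.Properties.Semiring.Exp semiring using (_^_; ^-congˡ; ^-assocʳ)
  open import Algebra.Properties.CommutativeSemiring.Exp commutativeSemiring using (^-distrib-*)
  open import Algebra.Properties.Semiring.Mult semiring using (_×_)
  open import Algebra.Properties.AbelianGroup +-abelianGroup using (x∙y⁻¹≈ε⇒x≈y; x≈y⇒x∙y⁻¹≈ε)
  open import Relation.Binary.Reasoning.Setoid setoid

  pw≡^ : ∀ x n → pw x n ≡ x ^ n
  pw≡^ x zero    = ≡.refl
  pw≡^ x (suc n) = ≡.cong (x *_) (pw≡^ x n)

  ×1≡×1# : ∀ n → n ×1 ≡ n × 1#
  ×1≡×1# zero    = ≡.refl
  ×1≡×1# (suc n) = ≡.cong (_+_ 1#) (×1≡×1# n)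

  x≉0⇒x*y≈0⇒y≈0 : ∀ {x y} → ¬ (x ≈ 0#) → x * y ≈ 0# → y ≈ 0#
  x≉0⇒x*y≈0⇒y≈0 {x} {y} x≉0 xy≈0 with inverse x x≉0
  ... | x⁻¹ , xx⁻¹≈1 = begin
    y                ≈⟨ *-identityˡ y ⟨
    1# * y           ≈⟨ *-congʳ (trans (*-comm x⁻¹ x) xx⁻¹≈1) ⟨
    (x⁻¹ * x) * y    ≈⟨ *-assoc x⁻¹ x y ⟩
    x⁻¹ * (x * y)    ≈⟨ *-congˡ xy≈0 ⟩
    x⁻¹ * 0#         ≈⟨ zeroʳ x⁻¹ ⟩
    0#               ∎

  xyz≈0⇒¬¬zeroFactor : ∀ {x y z} → x * y * z ≈ 0# → ¬ ¬ (x ≈ 0# ⊎ y ≈ 0# ⊎ z ≈ 0#)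
  xyz≈0⇒¬¬zeroFactor {x} {y} xyz≈0 ¬zero =
    ¬zero (inj₂ (inj₂ (x≉0⇒x*y≈0⇒y≈0 xy≉0 xyz≈0)))
    where
    xy≉0 : ¬ (x * y ≈ 0#)
    xy≉0 xy≈0 = ¬zero (inj₂ (inj₁ (x≉0⇒x*y≈0⇒y≈0 (¬zero ∘ inj₁) xy≈0)))

  Pointˢ : Setoid c ℓ
  Pointˢ = ×-setoid setoid (×-setoid setoid setoid)

  module ≈P = Setoid Pointˢ

  0ᴾ : Point
  0ᴾ = 0# , 0# , 0#

  infixl 21 _-ᴾ_
  infixr 22 _·ᴾ_

  _-ᴾ_ : Point → Point → Point
  (x₀ , x₁ , x₂) -ᴾ (y₀ , y₁ , y₂) = x₀ - y₀ , x₁ - y₁ , x₂ - y₂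

  _·ᴾ_ : Carrier → Point → Point
  z ·ᴾ (x₀ , x₁ , x₂) = z * x₀ , z * x₁ , z * x₂

  mapᴾ : (Carrier → Carrier) → Point → Point
  mapᴾ f (x₀ , x₁ , x₂) = f x₀ , f x₁ , f x₂

  rotate : Point → Point
  rotate (x₀ , x₁ , x₂) = x₂ , x₀ , x₁

  rotate-cong : ∀ {P Q} → P ≈P Q → rotate P ≈P rotate Q
  rotate-cong (e₀ , e₁ , e₂) = e₂ , e₀ , e₁

  dot : Point → Point → Carrier
  dot (x₀ , x₁ , x₂) (a₀ , a₁ , a₂) = (x₀ * a₀ + x₁ * a₁) + x₂ * a₂

  prod : Point → Carrier
  prod (x₀ , x₁ , x₂) = x₀ * x₁ * x₂

  x-y≈0⇒x≈y : ∀ {x y} → x - y ≈ 0# → x ≈ y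
  x-y≈0⇒x≈y = x∙y⁻¹≈ε⇒x≈y _ _

  x-ᴾy≈0⇒x≈y : ∀ {P Q} → P -ᴾ Q ≈P 0ᴾ → P ≈P Q
  x-ᴾy≈0⇒x≈y (e₀ , e₁ , e₂) = x-y≈0⇒x≈y e₀ , x-y≈0⇒x≈y e₁ , x-y≈0⇒x≈y e₂

  x≈y⇒x-ᴾy≈0 : ∀ {P Q} → P ≈P Q → P -ᴾ Q ≈P 0ᴾ
  x≈y⇒x-ᴾy≈0 (e₀ , e₁ , e₂) = x≈y⇒x∙y⁻¹≈ε e₀ , x≈y⇒x∙y⁻¹≈ε e₁ , x≈y⇒x∙y⁻¹≈ε e₂

  dot-cong : ∀ {P Q a b} → P ≈P Q → a ≈P b → dot P a ≈ dot Q b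
  dot-cong (p₀ , p₁ , p₂) (a₀ , a₁ , a₂) = +-cong (+-cong (*-cong p₀ a₀) (*-cong p₁ a₁)) (*-cong p₂ a₂)

  dot-scale : ∀ z P a → dot (z ·ᴾ P) a ≈ z * dot P a
  dot-scale z (x₀ , x₁ , x₂) (a₀ , a₁ , a₂) =
    solve 7 (λ z x₀ x₁ x₂ a₀ a₁ a₂ → (z :* x₀ :* a₀ :+ z :* x₁ :* a₁) :+ z :* x₂ :* a₂
                                      := z :* ((x₀ :* a₀ :+ x₁ :* a₁) :+ x₂ :* a₂)) refl z x₀ x₁ x₂ a₀ a₁ a₂

  dot-sub : ∀ P Q a → dot (P -ᴾ Q) a ≈ dot P a - dot Q a
  dot-sub (x₀ , x₁ , x₂) (y₀ , y₁ , y₂) (a₀ , a₁ , a₂) =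
    solve 9 (λ x₀ x₁ x₂ y₀ y₁ y₂ a₀ a₁ a₂ →
              ((x₀ :- y₀) :* a₀ :+ (x₁ :- y₁) :* a₁) :+ (x₂ :- y₂) :* a₂
              := ((x₀ :* a₀ :+ x₁ :* a₁) :+ x₂ :* a₂) :- ((y₀ :* a₀ :+ y₁ :* a₁) :+ y₂ :* a₂))
      refl x₀ x₁ x₂ y₀ y₁ y₂ a₀ a₁ a₂

  dot-0ʳ : ∀ P {a} → a ≈P 0ᴾ → dot P a ≈ 0#
  dot-0ʳ (x₀ , x₁ , x₂) (a₀ , a₁ , a₂) = begin
    (x₀ * _ + x₁ * _) + x₂ * _        ≈⟨ +-cong (+-cong (*-congˡ a₀) (*-congˡ a₁)) (*-congˡ a₂) ⟩
    (x₀ * 0# + x₁ * 0#) + x₂ * 0#     ≈⟨ +-cong (+-cong (zeroʳ x₀) (zeroʳ x₁)) (zeroʳ x₂) ⟩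
    (0# + 0#) + 0#                    ≈⟨ trans (+-identityʳ _) (+-identityʳ 0#) ⟩
    0#                                ∎

  dot-comm : ∀ P a → dot P a ≈ dot a P
  dot-comm (x₀ , x₁ , x₂) (a₀ , a₁ , a₂) = +-cong (+-cong (*-comm x₀ a₀) (*-comm x₁ a₁)) (*-comm x₂ a₂)

  dot-with-0₀₁ : ∀ {x₀ x₁ x₂} → x₀ ≈ 0# → x₁ ≈ 0# → ∀ a → dot (x₀ , x₁ , x₂) a ≈ x₂ * proj₂ (proj₂ a)
  dot-with-0₀₁ {x₂ = x₂} x₀≈0 x₁≈0 (a₀ , a₁ , a₂) = begin
    (_ * a₀ + _ * a₁) + x₂ * a₂      ≈⟨ +-congʳ (+-cong (*-congʳ x₀≈0) (*-congʳ x₁≈0)) ⟩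
    (0# * a₀ + 0# * a₁) + x₂ * a₂    ≈⟨ +-congʳ (trans (+-cong (zeroˡ a₀) (zeroˡ a₁)) (+-identityʳ 0#)) ⟩
    0# + x₂ * a₂                     ≈⟨ +-identityˡ _ ⟩
    x₂ * a₂                          ∎

  eval-cong : ∀ e {P Q} → P ≈P Q → eval e P ≈ eval e Q
  eval-cong (var zero)             (p₀ , _ , _) = p₀
  eval-cong (var (suc zero))       (_ , p₁ , _) = p₁
  eval-cong (var (suc (suc zero))) (_ , _ , p₂) = p₂
  eval-cong (con k)  P≈Q = refl
  eval-cong (e ⊕ f)  P≈Q = +-cong (eval-cong e P≈Q) (eval-cong f P≈Q)
  eval-cong (e ⊗ f)  P≈Q = *-cong (eval-cong e P≈Q) (eval-cong f P≈Q)
  eval-cong (⊖ e)    P≈Q = -‿cong (eval-cong e P≈Q)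

  cubic : Point → Point → Carrier → Point → Carrier
  cubic (a₀ , a₁ , a₂) (b₀ , b₁ , b₂) d (u₀ , u₁ , u₂) =
    (- (u₀ * u₁ * u₂) + ((a₀ * (u₀ * u₀) + b₀ * u₀ + (a₁ * (u₁ * u₁) + b₁ * u₁)) + (a₂ * (u₂ * u₂) + b₂ * u₂))) + d

  ∇cubic : Point → Point → Point → Point
  ∇cubic (a₀ , a₁ , a₂) (b₀ , b₁ , b₂) (u₀ , u₁ , u₂) =
    - (u₁ * u₂) + a₀ * (u₀ + u₀) + b₀ ,
    - (u₀ * u₂) + a₁ * (u₁ + u₁) + b₁ ,
    - (u₀ * u₁) + a₂ * (u₂ + u₂) + b₂

  -- The trapezoid rule is exact on the quadratic part of the cubic; the
  -- monomial −u₀u₁u₂ contributes exactly prod (v − u).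
  cubic-secant : ∀ a b d u v →
    (cubic a b d v + cubic a b d v) - (cubic a b d u + cubic a b d u)
      ≈ (dot (v -ᴾ u) (∇cubic a b u) + dot (v -ᴾ u) (∇cubic a b v)) + prod (v -ᴾ u)
  cubic-secant (a₀ , a₁ , a₂) (b₀ , b₁ , b₂) d (u₀ , u₁ , u₂) (v₀ , v₁ , v₂) =
    solve 13 (λ a₀ a₁ a₂ b₀ b₁ b₂ d u₀ u₁ u₂ v₀ v₁ v₂ →
      let f = λ x₀ x₁ x₂ → (:- (x₀ :* x₁ :* x₂) :+ ((a₀ :* (x₀ :* x₀) :+ b₀ :* x₀ :+ (a₁ :* (x₁ :* x₁) :+ b₁ :* x₁))
                              :+ (a₂ :* (x₂ :* x₂) :+ b₂ :* x₂))) :+ d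
          ∇f·δ = λ x₀ x₁ x₂ → ((v₀ :- u₀) :* (:- (x₁ :* x₂) :+ a₀ :* (x₀ :+ x₀) :+ b₀)
                               :+ (v₁ :- u₁) :* (:- (x₀ :* x₂) :+ a₁ :* (x₁ :+ x₁) :+ b₁))
                               :+ (v₂ :- u₂) :* (:- (x₀ :* x₁) :+ a₂ :* (x₂ :+ x₂) :+ b₂)
      in (f v₀ v₁ v₂ :+ f v₀ v₁ v₂) :- (f u₀ u₁ u₂ :+ f u₀ u₁ u₂)
         := (∇f·δ u₀ u₁ u₂ :+ ∇f·δ v₀ v₁ v₂) :+ (v₀ :- u₀) :* (v₁ :- u₁) :* (v₂ :- u₂))
      refl a₀ a₁ a₂ b₀ b₁ b₂ d u₀ u₁ u₂ v₀ v₁ v₂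

  cubic-criticalZeros : ∀ a b d u v → cubic a b d u ≈ 0# → cubic a b d v ≈ 0# →
    ∇cubic a b u ≈P 0ᴾ → ∇cubic a b v ≈P 0ᴾ → prod (v -ᴾ u) ≈ 0#
  cubic-criticalZeros a b d u v fu≈0 fv≈0 ∇fu≈0 ∇fv≈0 = begin
    prod (v -ᴾ u)                                            ≈⟨ +-identityˡ _ ⟨
    0# + prod (v -ᴾ u)                                       ≈⟨ +-congʳ (trans (+-cong (dot-0ʳ _ ∇fu≈0) (dot-0ʳ _ ∇fv≈0)) (+-identityʳ 0#)) ⟨
    (dot (v -ᴾ u) (∇cubic a b u) + dot (v -ᴾ u) (∇cubic a b v)) + prod (v -ᴾ u)
                                                             ≈⟨ cubic-secant a b d u v ⟨
    (cubic a b d v + cubic a b d v) - (cubic a b d u + cubic a b d u)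
                                                             ≈⟨ x≈y⇒x∙y⁻¹≈ε (trans (+-cong fv≈0 fv≈0) (sym (+-cong fu≈0 fu≈0))) ⟩
    0#                                                       ∎

  -- The Frobenius, the Moore matrix and the singular points

  module Frobenius (p m : ℕ) (p-prime : Prime p) (char : HasChar p) where

    q : ℕ
    q = p ℕ.^ m

    instance
      q≢0 : NonZero q
      q≢0 = ℕ.m^n≢0 p m {{prime⇒nonZero p-prime}}

    φ : Carrier → Carrier
    φ x = x ^ q

    φ-cong : ∀ {x y} → x ≈ y → φ x ≈ φ y
    φ-cong = ^-congˡ q

    φ-+ : ∀ x y → φ (x + y) ≈ φ x + φ y
    φ-+ = freshmansDream-^ commutativeSemiring p-prime (≡.subst (_≈ 0#) (×1≡×1# p) char) m

    φ-* : ∀ x y → φ (x * y) ≈ φ x * φ y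
    φ-* x y = ^-distrib-* x y q

    φ-0 : φ 0# ≈ 0#
    φ-0 = 0^n≈0 q
      where
      0^n≈0 : ∀ n → .{{NonZero n}} → 0# ^ n ≈ 0#
      0^n≈0 (suc n) = zeroˡ _

    φ-1 : φ 1# ≈ 1#
    φ-1 = 1^n≈1 q
      where
      1^n≈1 : ∀ n → 1# ^ n ≈ 1#
      1^n≈1 zero    = refl
      1^n≈1 (suc n) = trans (*-identityˡ _) (1^n≈1 n)

    φx-x≈0 : ∀ {x y} → x ≈ y → φ y ≈ y → φ x - x ≈ 0#
    φx-x≈0 x≈y φy≈y = x≈y⇒x∙y⁻¹≈ε (trans (φ-cong x≈y) (trans φy≈y (sym x≈y)))

    φᴾ : Point → Point
    φᴾ = mapᴾ φ

    φᴾ-cong : ∀ {P Q} → P ≈P Q → φᴾ P ≈P φᴾ Q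
    φᴾ-cong (p₀ , p₁ , p₂) = φ-cong p₀ , φ-cong p₁ , φ-cong p₂

    dot-φ : ∀ P a → φ (dot P a) ≈ dot (φᴾ P) (φᴾ a)
    dot-φ (x₀ , x₁ , x₂) (a₀ , a₁ , a₂) =
      trans (φ-+ _ _) (+-cong (trans (φ-+ _ _) (+-cong (φ-* x₀ a₀) (φ-* x₁ a₁))) (φ-* x₂ a₂))

    frob : ℕ → Carrier → Carrier
    frob j x = pw x (q ℕ.^ j)

    frob≈^ : ∀ j x → frob j x ≈ x ^ (q ℕ.^ j)
    frob≈^ j x = reflexive (pw≡^ x (q ℕ.^ j))

    frob-cong : ∀ j {x y} → x ≈ y → frob j x ≈ frob j y
    frob-cong j x≈y = trans (frob≈^ j _) (trans (^-congˡ (q ℕ.^ j) x≈y) (sym (frob≈^ j _)))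

    frob-zero : ∀ x → frob 0 x ≈ x
    frob-zero = *-identityʳ

    frob-+ : ∀ i j x → frob (i ℕ.+ j) x ≈ frob j (frob i x)
    frob-+ i j x = begin
      frob (i ℕ.+ j) x                  ≈⟨ frob≈^ (i ℕ.+ j) x ⟩
      x ^ (q ℕ.^ (i ℕ.+ j))             ≡⟨ ≡.cong (x ^_) (ℕ.^-distribˡ-+-* q i j) ⟩
      x ^ (q ℕ.^ i ℕ.* q ℕ.^ j)         ≈⟨ ^-assocʳ x (q ℕ.^ i) (q ℕ.^ j) ⟨
      (x ^ (q ℕ.^ i)) ^ (q ℕ.^ j)       ≈⟨ ^-congˡ (q ℕ.^ j) (frob≈^ i x) ⟨
      (frob i x) ^ (q ℕ.^ j)            ≈⟨ frob≈^ j (frob i x) ⟨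
      frob j (frob i x)                 ∎

    frob-suc : ∀ j x → frob (suc j) x ≈ φ (frob j x)
    frob-suc j x = begin
      frob (suc j) x                    ≡⟨ ≡.cong (λ k → frob k x) (ℕ.+-comm 1 j) ⟩
      frob (j ℕ.+ 1) x                  ≈⟨ frob-+ j 1 x ⟩
      frob 1 (frob j x)                 ≈⟨ trans (frob≈^ 1 _) (reflexive (≡.cong (frob j x ^_) (ℕ.*-identityʳ q))) ⟩
      φ (frob j x)                      ∎

    frobP-suc : ∀ k P → frobP q (suc k) P ≈P φᴾ (frobP q k P)
    frobP-suc k (x₀ , x₁ , x₂) = frob-suc k x₀ , frob-suc k x₁ , frob-suc k x₂

    frobP-zero : ∀ P → frobP q 0 P ≈P P
    frobP-zero (x₀ , x₁ , x₂) = frob-zero x₀ , frob-zero x₁ , frob-zero x₂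

    frobP-one : ∀ P → frobP q 1 P ≈P φᴾ P
    frobP-one P = ≈P.trans (frobP-suc 0 P) (φᴾ-cong (frobP-zero P))

    φ-fixed⇒In𝔽 : ∀ {x} → φ x ≈ x → In𝔽 q 1 x
    φ-fixed⇒In𝔽 {x} φx≈x = trans (frob-suc 0 x) (trans (φ-cong (frob-zero x)) φx≈x)

    φ⁴ : Carrier → Carrier
    φ⁴ x = φ (φ (φ (φ x)))

    φ⁴-cong : ∀ {x y} → x ≈ y → φ⁴ x ≈ φ⁴ y
    φ⁴-cong = φ-cong ∘ φ-cong ∘ φ-cong ∘ φ-cong

    -- φ commutes with φ⁴, so agreement of φ and φ⁴ at x passes to φ⁴ x, i.e. to the next coordinate.
    agree-somewhere⇒everywhere : ∀ {v₀ v₁ v₂ w₀ w₁ w₂} →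
      (v₀ , v₁ , v₂) ≈P φᴾ (rotate (w₀ , w₁ , w₂)) → (w₀ , w₁ , w₂) ≈P mapᴾ φ⁴ (rotate (w₀ , w₁ , w₂)) →
      v₀ ≈ w₀ ⊎ v₁ ≈ w₁ ⊎ v₂ ≈ w₂ → (v₀ , v₁ , v₂) ≈P (w₀ , w₁ , w₂)
    agree-somewhere⇒everywhere {w₀ = w₀} {w₁} {w₂} (v₀≈ , v₁≈ , v₂≈) (w₀≈ , w₁≈ , w₂≈) somewhere =
      agreeAt⇒≈ v₀≈ w₀≈ agree₂ , agreeAt⇒≈ v₁≈ w₁≈ agree₀ , agreeAt⇒≈ v₂≈ w₂≈ agree₁
      where
      Agree : Carrier → Set ℓ
      Agree x = φ x ≈ φ⁴ x
      next : ∀ {x y} → y ≈ φ⁴ x → Agree x → Agree y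
      next y≈φ⁴x φx≈φ⁴x = trans (φ-cong y≈φ⁴x) (trans (φ⁴-cong φx≈φ⁴x) (sym (φ⁴-cong y≈φ⁴x)))
      ≈⇒agreeAt : ∀ {v w x} → v ≈ φ x → w ≈ φ⁴ x → v ≈ w → Agree x
      ≈⇒agreeAt v≈φx w≈φ⁴x v≈w = trans (sym v≈φx) (trans v≈w w≈φ⁴x)
      agreeAt⇒≈ : ∀ {v w x} → v ≈ φ x → w ≈ φ⁴ x → Agree x → v ≈ w
      agreeAt⇒≈ v≈φx w≈φ⁴x φx≈φ⁴x = trans v≈φx (trans φx≈φ⁴x (sym w≈φ⁴x))
      agree₂ : Agree w₂
      agree₂ = [ ≈⇒agreeAt v₀≈ w₀≈
               , [ next w₂≈ ∘ next w₁≈ ∘ ≈⇒agreeAt v₁≈ w₁≈ , next w₂≈ ∘ ≈⇒agreeAt v₂≈ w₂≈ ]′ ]′ somewhere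
      agree₀ : Agree w₀
      agree₀ = next w₀≈ agree₂
      agree₁ : Agree w₁
      agree₁ = next w₁≈ agree₀

    module NormalBasis (α : Carrier) (normal : NormalBasisGen q α) where

      -- ξᴾ R = (ξ₀, ξ₁, ξ₂) at R: eval (Surface.ξ j) R is definitionally dot R (cᵛ j).
      cᵛ : ℕ → Point
      cᵛ j = frob j α , frob (suc j) α , frob (suc (suc j)) α

      ξᴾ : Point → Point
      ξᴾ P = dot P (cᵛ 0) , dot P (cᵛ 1) , dot P (cᵛ 2)

      ξᴾ-cong : ∀ {P Q} → P ≈P Q → ξᴾ P ≈P ξᴾ Q
      ξᴾ-cong P≈Q = dot-cong P≈Q ≈P.refl , dot-cong P≈Q ≈P.refl , dot-cong P≈Q ≈P.refl

      ξᴾ-sub : ∀ P Q → ξᴾ (P -ᴾ Q) ≈P ξᴾ P -ᴾ ξᴾ Q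
      ξᴾ-sub P Q = dot-sub P Q (cᵛ 0) , dot-sub P Q (cᵛ 1) , dot-sub P Q (cᵛ 2)

      ξᴾ-scale : ∀ z P → ξᴾ (z ·ᴾ P) ≈P z ·ᴾ ξᴾ P
      ξᴾ-scale z P = dot-scale z P (cᵛ 0) , dot-scale z P (cᵛ 1) , dot-scale z P (cᵛ 2)

      cᵛ-suc : ∀ j → cᵛ (suc j) ≈P φᴾ (cᵛ j)
      cᵛ-suc j = frob-suc j α , frob-suc (suc j) α , frob-suc (suc (suc j)) α

      cᵛ-period : ∀ j → cᵛ (3 ℕ.+ j) ≈P cᵛ j
      cᵛ-period j = period j , period (suc j) , period (suc (suc j))
        where
        period : ∀ j → frob (3 ℕ.+ j) α ≈ frob j α
        period j = trans (frob-+ 3 j α) (frob-cong j (proj₁ normal))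

      dot-φᴾ-cᵛ : ∀ j P → dot (φᴾ P) (cᵛ (suc j)) ≈ φ (dot P (cᵛ j))
      dot-φᴾ-cᵛ j P = trans (dot-cong ≈P.refl (cᵛ-suc j)) (sym (dot-φ P (cᵛ j)))

      ξᴾ-φᴾ : ∀ P → ξᴾ (φᴾ P) ≈P φᴾ (rotate (ξᴾ P))
      ξᴾ-φᴾ P = trans (dot-cong ≈P.refl (≈P.sym (cᵛ-period 0))) (dot-φᴾ-cᵛ 2 P) , dot-φᴾ-cᵛ 0 P , dot-φᴾ-cᵛ 1 P

      independent : ∀ {P} → φᴾ P ≈P P → dot P (cᵛ 0) ≈ 0# → P ≈P 0ᴾ
      independent {x₀ , x₁ , x₂} (f₀ , f₁ , f₂) dot≈0 =
        proj₂ normal x₀ x₁ x₂ (φ-fixed⇒In𝔽 f₀) (φ-fixed⇒In𝔽 f₁) (φ-fixed⇒In𝔽 f₂) (begin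
          x₀ * α + (x₁ * pw α q + x₂ * frob 2 α)       ≈⟨ +-assoc _ _ _ ⟨
          x₀ * α + x₁ * pw α q + x₂ * frob 2 α         ≈⟨ +-congʳ (+-cong (*-congˡ (frob-zero α)) (*-congˡ (reflexive (≡.cong (pw α) (ℕ.*-identityʳ q))))) ⟨
          dot (x₀ , x₁ , x₂) (cᵛ 0)                    ≈⟨ dot≈0 ⟩
          0#                                           ∎)

      frobξ : ℕ → Point → Point
      frobξ zero    Q = Q
      frobξ (suc k) Q = φᴾ (rotate (frobξ k Q))

      ξᴾ-frobP : ∀ k P → ξᴾ (frobP q k P) ≈P frobξ k (ξᴾ P)
      ξᴾ-frobP zero    P = ξᴾ-cong (frobP-zero P)
      ξᴾ-frobP (suc k) P = ≈P.trans (ξᴾ-cong (frobP-suc k P))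
                             (≈P.trans (ξᴾ-φᴾ (frobP q k P)) (φᴾ-cong (rotate-cong (ξᴾ-frobP k P))))

      Ker : Point → Set ℓ
      Ker P = ξᴾ P ≈P 0ᴾ

      Ker-scale : ∀ z {P} → Ker P → Ker (z ·ᴾ P)
      Ker-scale z {P} (k₀ , k₁ , k₂) = ≈P.trans (ξᴾ-scale z P) (z*0 k₀ , z*0 k₁ , z*0 k₂)
        where
        z*0 : ∀ {x} → x ≈ 0# → z * x ≈ 0#
        z*0 x≈0 = trans (*-congˡ x≈0) (zeroʳ z)

      Ker-φ-difference : ∀ {P} → Ker P → Ker (φᴾ P -ᴾ P)
      Ker-φ-difference {P} kerP = ≈P.trans (ξᴾ-sub (φᴾ P) P) (x≈y⇒x-ᴾy≈0 (≈P.trans kerφP (≈P.sym kerP)))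
        where
        kerφP : Ker (φᴾ P)
        kerφP = ≈P.trans (ξᴾ-φᴾ P) (≈P.trans (φᴾ-cong (rotate-cong kerP)) (φ-0 , φ-0 , φ-0))

      frob₂α≉0 : ¬ (frob 2 α ≈ 0#)
      frob₂α≉0 frob₂α≈0 = 1≉0 (proj₂ (proj₂ (independent (φ-0 , φ-0 , φ-1) (begin
        dot (0# , 0# , 1#) (cᵛ 0)      ≈⟨ dot-with-0₀₁ refl refl (cᵛ 0) ⟩
        1# * frob 2 α                  ≈⟨ *-identityˡ _ ⟩
        frob 2 α                       ≈⟨ frob₂α≈0 ⟩
        0#                             ∎))))

      ker-last : ∀ {x₀ x₁ x₂} → Ker (x₀ , x₁ , x₂) → x₀ ≈ 0# → x₁ ≈ 0# → x₂ ≈ 0#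
      ker-last {x₀} {x₁} {x₂} (k₀ , _ , _) x₀≈0 x₁≈0 =
        x≉0⇒x*y≈0⇒y≈0 frob₂α≉0 (trans (*-comm _ x₂) (trans (sym (dot-with-0₀₁ x₀≈0 x₁≈0 (cᵛ 0))) k₀))

      ker-rational₀₁⇒0 : ∀ {x₀ x₁ x₂} → Ker (x₀ , x₁ , x₂) → φ x₀ - x₀ ≈ 0# → φ x₁ - x₁ ≈ 0# →
                          (x₀ , x₁ , x₂) ≈P 0ᴾ
      ker-rational₀₁⇒0 kerP g₀≈0 g₁≈0 =
        independent (x-ᴾy≈0⇒x≈y (g₀≈0 , g₁≈0 , ker-last (Ker-φ-difference kerP) g₀≈0 g₁≈0)) (proj₁ kerP)

      -- Normalise the first nonzero coordinate of a kernel vector f to 1: then φf − f is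
      -- a kernel vector with one more leading zero, so f is 𝔽_q-rational, against independence.
      ker-middle : ∀ {x₀ x₁ x₂} → Ker (x₀ , x₁ , x₂) → x₀ ≈ 0# → ¬ ¬ (x₁ ≈ 0#)
      ker-middle {x₀} {x₁} kerP x₀≈0 x₁≉0 with inverse x₁ x₁≉0
      ... | y , x₁y≈1 = 1≉0 (trans (sym yx₁≈1) (proj₁ (proj₂ (ker-rational₀₁⇒0 (Ker-scale y kerP) g₀≈0 g₁≈0))))
        where
        yx₁≈1 : y * x₁ ≈ 1#
        yx₁≈1 = trans (*-comm y x₁) x₁y≈1
        g₀≈0 : φ (y * x₀) - y * x₀ ≈ 0#
        g₀≈0 = φx-x≈0 (trans (*-congˡ x₀≈0) (zeroʳ y)) φ-0
        g₁≈0 : φ (y * x₁) - y * x₁ ≈ 0#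
        g₁≈0 = φx-x≈0 yx₁≈1 φ-1

      ker-first : ∀ {x₀ x₁ x₂} → Ker (x₀ , x₁ , x₂) → ¬ ¬ (x₀ ≈ 0#)
      ker-first {x₀} {x₁} {x₂} kerP x₀≉0 with inverse x₀ x₀≉0
      ... | y , x₀y≈1 = ker-middle (Ker-φ-difference kerf) g₀≈0 λ g₁≈0 →
              1≉0 (trans (sym yx₀≈1) (proj₁ (ker-rational₀₁⇒0 kerf g₀≈0 g₁≈0)))
        where
        kerf : Ker (y ·ᴾ (x₀ , x₁ , x₂))
        kerf = Ker-scale y kerP
        yx₀≈1 : y * x₀ ≈ 1#
        yx₀≈1 = trans (*-comm y x₀) x₀y≈1
        g₀≈0 : φ (y * x₀) - y * x₀ ≈ 0#
        g₀≈0 = φx-x≈0 yx₀≈1 φ-1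

      ker⇒¬¬0 : ∀ {P} → Ker P → ¬ ¬ (P ≈P 0ᴾ)
      ker⇒¬¬0 kerP P≉0 = ker-first kerP λ x₀≈0 → ker-middle kerP x₀≈0 λ x₁≈0 →
        P≉0 (x₀≈0 , x₁≈0 , ker-last kerP x₀≈0 x₁≈0)

      module Singularities (A B C : Carrier) where
        open Surface q α A B C

        Aᵛ Bᵛ : Point
        Aᵛ = fr 0 A , fr 1 A , fr 2 A
        Bᵛ = fr 0 B , fr 1 B , fr 2 B

        eval-F≡cubic : ∀ R → eval F R ≡ cubic Aᵛ Bᵛ D (ξᴾ R)
        eval-F≡cubic R = ≡.refl

        ∂ξ : Fin 3 → Point → Point
        ∂ξ i R = eval (deriv i (ξ 0)) R , eval (deriv i (ξ 1)) R , eval (deriv i (ξ 2)) R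

        chainRule : ∀ i R → eval (deriv i F) R ≈ dot (∂ξ i R) (∇cubic Aᵛ Bᵛ (ξᴾ R))
        chainRule i R = solve 12 (λ u₀ u₁ u₂ δ₀ δ₁ δ₂ a₀ a₁ a₂ b₀ b₁ b₂ →
          let d = λ a b u δ → (con (+ 0) :* (u :* u) :+ a :* (δ :* u :+ u :* δ)) :+ (con (+ 0) :* u :+ b :* δ)
          in (:- ((δ₀ :* u₁ :+ u₀ :* δ₁) :* u₂ :+ u₀ :* u₁ :* δ₂) :+ ((d a₀ b₀ u₀ δ₀ :+ d a₁ b₁ u₁ δ₁) :+ d a₂ b₂ u₂ δ₂))
             :+ con (+ 0)
             := (δ₀ :* (:- (u₁ :* u₂) :+ a₀ :* (u₀ :+ u₀) :+ b₀) :+ δ₁ :* (:- (u₀ :* u₂) :+ a₁ :* (u₁ :+ u₁) :+ b₁))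
                :+ δ₂ :* (:- (u₀ :* u₁) :+ a₂ :* (u₂ :+ u₂) :+ b₂))
          refl (eval (ξ 0) R) (eval (ξ 1) R) (eval (ξ 2) R)
               (eval (deriv i (ξ 0)) R) (eval (deriv i (ξ 1)) R) (eval (deriv i (ξ 2)) R)
               (fr 0 A) (fr 1 A) (fr 2 A) (fr 0 B) (fr 1 B) (fr 2 B)

        -- 1# is a solver variable here: the coefficient con (+ 1) evaluates to 1# + 0#, not 1#.
        ∂₀-linearForm : ∀ k₀ k₁ k₂ x₀ x₁ x₂ → ((1# * k₀ + x₀ * 0#) + (0# * k₁ + x₁ * 0#)) + (0# * k₂ + x₂ * 0#) ≈ k₀
        ∂₀-linearForm k₀ k₁ k₂ x₀ x₁ x₂ = trans (solve 7 (λ one k₀ k₁ k₂ x₀ x₁ x₂ →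
          ((one :* k₀ :+ x₀ :* con (+ 0)) :+ (con (+ 0) :* k₁ :+ x₁ :* con (+ 0))) :+ (con (+ 0) :* k₂ :+ x₂ :* con (+ 0))
          := one :* k₀) refl 1# k₀ k₁ k₂ x₀ x₁ x₂) (*-identityˡ k₀)

        ∂₁-linearForm : ∀ k₀ k₁ k₂ x₀ x₁ x₂ → ((0# * k₀ + x₀ * 0#) + (1# * k₁ + x₁ * 0#)) + (0# * k₂ + x₂ * 0#) ≈ k₁
        ∂₁-linearForm k₀ k₁ k₂ x₀ x₁ x₂ = trans (solve 7 (λ one k₀ k₁ k₂ x₀ x₁ x₂ →
          ((con (+ 0) :* k₀ :+ x₀ :* con (+ 0)) :+ (one :* k₁ :+ x₁ :* con (+ 0))) :+ (con (+ 0) :* k₂ :+ x₂ :* con (+ 0))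
          := one :* k₁) refl 1# k₀ k₁ k₂ x₀ x₁ x₂) (*-identityˡ k₁)

        ∂₂-linearForm : ∀ k₀ k₁ k₂ x₀ x₁ x₂ → ((0# * k₀ + x₀ * 0#) + (0# * k₁ + x₁ * 0#)) + (1# * k₂ + x₂ * 0#) ≈ k₂
        ∂₂-linearForm k₀ k₁ k₂ x₀ x₁ x₂ = trans (solve 7 (λ one k₀ k₁ k₂ x₀ x₁ x₂ →
          ((con (+ 0) :* k₀ :+ x₀ :* con (+ 0)) :+ (con (+ 0) :* k₁ :+ x₁ :* con (+ 0))) :+ (one :* k₂ :+ x₂ :* con (+ 0))
          := one :* k₂) refl 1# k₀ k₁ k₂ x₀ x₁ x₂) (*-identityˡ k₂)

        ∂ξ-row : ∀ i R → ∂ξ i R ≈P cᵛ (toℕ i)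
        ∂ξ-row zero             (x₀ , x₁ , x₂) =
          ∂₀-linearForm _ _ _ x₀ x₁ x₂ , ∂₀-linearForm _ _ _ x₀ x₁ x₂ , ∂₀-linearForm _ _ _ x₀ x₁ x₂
        ∂ξ-row (suc zero)       (x₀ , x₁ , x₂) =
          ∂₁-linearForm _ _ _ x₀ x₁ x₂ , ∂₁-linearForm _ _ _ x₀ x₁ x₂ , ∂₁-linearForm _ _ _ x₀ x₁ x₂
        ∂ξ-row (suc (suc zero)) (x₀ , x₁ , x₂) =
          ∂₂-linearForm _ _ _ x₀ x₁ x₂ , ∂₂-linearForm _ _ _ x₀ x₁ x₂ , ∂₂-linearForm _ _ _ x₀ x₁ x₂

        ∇F : Point → Point
        ∇F R = eval (deriv zero F) R , eval (deriv (suc zero) F) R , eval (deriv (suc (suc zero)) F) R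

        -- The Jacobian (α^{q^{i+j}}) of ξᴾ is symmetric, so its transpose is ξᴾ again.
        ∇F≈ξᴾ∇cubic : ∀ R → ∇F R ≈P ξᴾ (∇cubic Aᵛ Bᵛ (ξᴾ R))
        ∇F≈ξᴾ∇cubic R = entry zero , entry (suc zero) , entry (suc (suc zero))
          where
          entry : ∀ i → eval (deriv i F) R ≈ dot (∇cubic Aᵛ Bᵛ (ξᴾ R)) (cᵛ (toℕ i))
          entry i = trans (chainRule i R) (trans (dot-cong (∂ξ-row i R) ≈P.refl) (dot-comm _ _))

        singular⇒critical : ∀ {R} → Singular R → ¬ ¬ (∇cubic Aᵛ Bᵛ (ξᴾ R) ≈P 0ᴾ)
        singular⇒critical {R} (_ , ∂F≈0) =
          ker⇒¬¬0 (≈P.trans (≈P.sym (∇F≈ξᴾ∇cubic R)) (∂F≈0 zero , ∂F≈0 (suc zero) , ∂F≈0 (suc (suc zero))))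

        singular-secant : ∀ {P Q} → Singular P → Singular Q → ¬ ¬ (prod (ξᴾ Q -ᴾ ξᴾ P) ≈ 0#)
        singular-secant {P} {Q} singP singQ prod≉0 =
          singular⇒critical singP λ ∇P≈0 → singular⇒critical singQ λ ∇Q≈0 →
          prod≉0 (cubic-criticalZeros Aᵛ Bᵛ D (ξᴾ P) (ξᴾ Q) (zero-of singP) (zero-of singQ) ∇P≈0 ∇Q≈0)
          where
          zero-of : ∀ {R} → Singular R → cubic Aᵛ Bᵛ D (ξᴾ R) ≈ 0#
          zero-of {R} (F≈0 , _) = trans (reflexive (≡.sym (eval-F≡cubic R))) F≈0

        singular-resp : ∀ {P Q} → P ≈P Q → Singular P → Singular Q
        singular-resp P≈Q (F≈0 , ∂F≈0) =
          trans (sym (eval-cong F P≈Q)) F≈0 , λ i → trans (sym (eval-cong (deriv i F) P≈Q)) (∂F≈0 i)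

        conjugate-singular⇒fixed : ∀ {P} → frobP q 4 P ≈P P → Singular P → Singular (frobP q 1 P) →
                                   ¬ ¬ (P ≈P frobP q 1 P)
        conjugate-singular⇒fixed {P} P⁴≈P singP singP¹ P≉P¹ =
          singular-secant singP (singular-resp (frobP-one P) singP¹) λ prod≈0 →
          xyz≈0⇒¬¬zeroFactor prod≈0 λ someFactor≈0 →
          ker⇒¬¬0 (ξφP≈ξP⇒ker (agree-somewhere⇒everywhere (ξᴾ-φᴾ P) ξP-periodic (difference≈0⇒≈ someFactor≈0)))
            λ φP-P≈0 → P≉P¹ (≈P.sym (≈P.trans (frobP-one P) (x-ᴾy≈0⇒x≈y φP-P≈0)))
          where
          ξP-periodic : ξᴾ P ≈P frobξ 4 (ξᴾ P)
          ξP-periodic = ≈P.trans (ξᴾ-cong (≈P.sym P⁴≈P)) (ξᴾ-frobP 4 P)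
          ξφP≈ξP⇒ker : ξᴾ (φᴾ P) ≈P ξᴾ P → Ker (φᴾ P -ᴾ P)
          ξφP≈ξP⇒ker ξφP≈ξP = ≈P.trans (ξᴾ-sub (φᴾ P) P) (x≈y⇒x-ᴾy≈0 ξφP≈ξP)
          difference≈0⇒≈ : ∀ {d₀ d₁ d₂ e₀ e₁ e₂} → d₀ - e₀ ≈ 0# ⊎ d₁ - e₁ ≈ 0# ⊎ d₂ - e₂ ≈ 0# →
                           d₀ ≈ e₀ ⊎ d₁ ≈ e₁ ⊎ d₂ ≈ e₂
          difference≈0⇒≈ = Data.Sum.map x-y≈0⇒x≈y (Data.Sum.map x-y≈0⇒x≈y x-y≈0⇒x≈y)

open import Data.Nat using (_^_)

mainTheorem8 : ∀ {c ℓ} (K : Field c ℓ) → let open FieldDefs K in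
    IsAlgClosed →
    (p m : ℕ) → Prime p → 1 ≤ m → HasChar p →
    (α A B C : Carrier) → NormalBasisGen (p ^ m) α →
    In𝔽 (p ^ m) 3 A → In𝔽 (p ^ m) 3 B → In𝔽 (p ^ m) 3 C →
    ¬ (A ≈ 0#) → ¬ (B ≈ 0#) →
    ¬ FourConjugateSingular (p ^ m) α A B C
mainTheorem8 K _ p m p-prime _ char α A B C normal _ _ _ _ _ (P , P⁴≈P , distinct , _ , singular) =
  conjugate-singular⇒fixed P⁴≈P (singular zero) (singular (suc zero)) (distinct zero (suc zero) (λ ()))
  where
  open Frobenius K p m p-prime char
  open NormalBasis α normal
  open Singularities A B C
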